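{- There is a function $p$ such that for every two reals $d>d'\geq 2$, every graph $G$ with average degree at least $d$ contains a subgraph with average degree at least $d'$ and diameter at most $p(d,d')\cdot\log|G|$.
   Context: Graphs are finite, simple and undirected; $|G|$ is the number of vertices of $G$; the average degree of $G$ is $2|E(G)|/|V(G)|$. Logarithms are binary.
   Formalization: The parameters $d>d'\geq 2$ range over the rationals instead of the reals. -}

module Defs where

open import Data.Nat using (ℕ; zero; suc; _+_; _*_; _≤_; _<ᵇ_; NonZero)
open import Data.Bool using (Bool; true; false; if_then_else_; _∧_)
open import Data.Fin using (Fin; toℕ)
open import Data.List using (List; map; allFin)
open import Data.Nat.ListAction using (sum)
open import Data.Integer using (+_)
open import Data.Rational using (ℚ; _/_)
import Data.Rational as ℚ
open import Data.Product using (Σ; ∃; _×_)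
open import Relation.Binary.PropositionalEquality using (_≡_)
open import Function.Definitions using (Injective)

record Graph : Set where
  field
    n      : ℕ
    adj    : Fin n → Fin n → Bool
    sym    : ∀ i j → adj i j ≡ adj j i
    irrefl : ∀ i → adj i i ≡ false
open Graph public

∣_∣ᵥ : Graph → ℕ
∣ G ∣ᵥ = n G

edgeCount : Graph → ℕ
edgeCount G =
  sum (map (λ i → sum (map (λ j → if (toℕ i <ᵇ toℕ j) ∧ adj G i j then 1 else 0)
                           (allFin (n G))))
           (allFin (n G)))

ℕ→ℚ : ℕ → ℚ
ℕ→ℚ m = (+ m) / 1

-- "G has average degree at least d": |G| > 0 and 2|E(G)|/|G| ≥ d,
-- written without division as  d * |G| ≤ 2|E(G)|.
AvgDegAtLeast : Graph → ℚ → Set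
AvgDegAtLeast G d = (0 Data.Nat.< n G) × (d ℚ.* ℕ→ℚ (n G) ℚ.≤ ℕ→ℚ (2 * edgeCount G))

data Walk (G : Graph) : Fin (n G) → Fin (n G) → ℕ → Set where
  here : ∀ {u} → Walk G u u 0
  step : ∀ {u w v k} → adj G u w ≡ true → Walk G w v k → Walk G u v (suc k)

DistAtMost : (G : Graph) → Fin (n G) → Fin (n G) → ℕ → Set
DistAtMost G u v k = Σ ℕ (λ l → (l ≤ k) × Walk G u v l)

DiamAtMost : Graph → ℕ → Set
DiamAtMost G k = ∀ u v → DistAtMost G u v k

record Subgraph (H G : Graph) : Set where
  field
    emb     : Fin (n H) → Fin (n G)
    emb-inj : Injective _≡_ _≡_ emb
    emb-adj : ∀ i j → adj H i j ≡ true → adj G (emb i) (emb j) ≡ true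

-- Grow breadth-first balls around a vertex v inside the current vertex set S, whose
-- average degree is at least d. As long as the next ball B(r+1) has average degree
-- below d′ and the rest S ∖ B(r) has average degree at most d, double counting the
-- edges of S (each one lies in B(r+1) or in S ∖ B(r)) forces |B(r+1)| > (d/d′)|B(r)|.
-- Such growth can last only O(log |G|) rounds, so at the first round where it fails
-- either B(r+1) is the desired subgraph, or S ∖ B(r) is denser than d and we start
-- over inside this strictly smaller set.
module Submission where

open import Defs renaming (sym to adj-sym)
import Algebra.Properties.CommutativeMonoid.Sum as Sum
open import Data.Bool using (Bool; true; false; if_then_else_; _∧_; _∨_; not)
open import Data.Bool.Properties using (∧-conicalˡ; ∧-conicalʳ; ∨-zeroʳ; T-≡) renaming (_≟_ to _≟ᵇ_)
open import Data.Empty using (⊥-elim)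
open import Data.Fin using (Fin; zero; suc; toℕ; _≟_)
open import Data.Fin.Properties using (suc-injective; any?; toℕ<n)
import Data.Integer as ℤ
import Data.Integer.Properties as ℤ
open import Data.List using (map; allFin; tabulate)
import Data.Nat.ListAction as List
open import Data.Nat using (ℕ; zero; suc; _+_; _*_; _^_; _≤_; _<_; _≤?_; _<?_; z≤n; s≤s; _<ᵇ_; NonZero; >-nonZero)
open import Data.Nat.Properties hiding (suc-injective; _≟_)
open import Data.Nat.DivMod as DivMod using (_%_; m≡m%n+[m/n]*n; m%n<n; m/n*n≤m)
open import Data.Nat.Induction using (<-wellFounded)
open import Data.Nat.Logarithm using (⌊log₂_⌋; ⌊log₂⌋-mono-≤; ⌊log₂[2^n]⌋≡n)
open import Data.Nat.Coprimality using (Coprime)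
open import Data.Nat.Tactic.RingSolver using (solve-∀)
open import Data.Product using (Σ; ∃; ∃₂; _×_; _,_)
open import Data.Rational as ℚ using (ℚ; mkℚ; toℚᵘ)
import Data.Rational.Properties as ℚ
open import Data.Rational.Unnormalised as ℚᵘ using (mkℚᵘ; *≤*)
import Data.Rational.Unnormalised.Properties as ℚᵘ
open import Data.Sum using (_⊎_; inj₁; inj₂; [_,_])
open import Function using (_∘_; _on_)
open import Function.Bundles using (_⇔_; mk⇔; Equivalence)
import Function.Properties.Equivalence as ⇔
open import Induction.WellFounded using (Acc; acc)
import Relation.Binary.Construct.On as On
open import Relation.Binary.PropositionalEquality hiding ([_])
open import Relation.Nullary using (¬_; Dec; does; yes; no)
open import Relation.Nullary.Decidable using (dec-true)
open import Relation.Unary using (Decidable)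

open Sum +-0-commutativeMonoid using (sum; sum-cong-≗; ∑-distrib-+; sum-remove; sum-replicate-zero)

-- Arithmetic

n<2^n : ∀ n → n < 2 ^ n
n<2^n zero = s≤s z≤n
n<2^n (suc n) = begin-strict
  suc n             ≤⟨ n<2^n n ⟩
  2 ^ n             <⟨ m<m+n (2 ^ n) (m^n>0 2 n) ⟩
  2 ^ n + 2 ^ n     ≡⟨ cong (2 ^ n +_) (sym (+-identityʳ (2 ^ n))) ⟩
  2 ^ suc n         ∎
  where open ≤-Reasoning

m<n*o⇒0<n : ∀ {m n o} → m < n * o → 0 < n
m<n*o⇒0<n {n = suc _} _ = s≤s z≤n

m<n*[2*o]⇒0<o : ∀ {m} n o → m < n * (2 * o) → 0 < o
m<n*[2*o]⇒0<o {m} n zero h with () ← subst (m <_) (*-zeroʳ n) h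
m<n*[2*o]⇒0<o n (suc o) _ = s≤s z≤n

2^≤⇒≤⌊log₂⌋ : ∀ {a m} → 2 ^ a ≤ m → a ≤ ⌊log₂ m ⌋
2^≤⇒≤⌊log₂⌋ {a} h = subst (_≤ _) (⌊log₂[2^n]⌋≡n a) (⌊log₂⌋-mono-≤ h)

-- The factor 4 in the exponent pays for 2^(q+1) ≤ n², i.e. for rounding q = ⌊log₂ n⌋ up.
log₂-radius-bound : ∀ {n q} k → 2 ≤ n → 2 ^ q ≤ n → 2 * (suc q * k) ≤ ⌊log₂ (n ^ (4 * k)) ⌋
log₂-radius-bound {n} {q} k 2≤n 2^q≤n = 2^≤⇒≤⌊log₂⌋ (begin
  2 ^ (2 * (suc q * k))   ≡⟨ cong (2 ^_) (exponents q k) ⟩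
  2 ^ (suc q * (2 * k))   ≡⟨ ^-*-assoc 2 (suc q) (2 * k) ⟨
  (2 * 2 ^ q) ^ (2 * k)   ≤⟨ ^-monoˡ-≤ (2 * k) (*-mono-≤ 2≤n 2^q≤n) ⟩
  (n * n) ^ (2 * k)       ≡⟨ cong (λ m → (n * m) ^ (2 * k)) (*-identityʳ n) ⟨
  (n ^ 2) ^ (2 * k)       ≡⟨ ^-*-assoc n 2 (2 * k) ⟩
  n ^ (2 * (2 * k))       ≡⟨ cong (n ^_) (*-assoc 2 2 k) ⟨
  n ^ (4 * k)             ∎)
  where
  open ≤-Reasoning
  exponents : ∀ q k → 2 * (suc q * k) ≡ suc q * (2 * k)
  exponents = solve-∀

least-failure : ∀ {p} {P : ℕ → Set p} → Decidable P → ∀ R →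
  (∀ r → r < R → P r) ⊎ ∃ λ r → r < R × ¬ P r × (∀ r′ → r′ < r → P r′)
least-failure P? zero = inj₁ (λ _ ())
least-failure P? (suc R) with least-failure P? R
... | inj₂ (r , r<R , ¬Pr , below) = inj₂ (r , m<n⇒m<1+n r<R , ¬Pr , below)
... | inj₁ below with P? R
...   | no ¬PR = inj₂ (R , n<1+n R , ¬PR , below)
...   | yes PR = inj₁ λ r r<1+R → [ below r , (λ { refl → PR }) ] (m<1+n⇒m<n∨m≡n r<1+R)

steady-growth : ∀ k .{{_ : NonZero k}} (b : ℕ → ℕ) r m →
  (∀ j → j < m → suc k * b (j + r) ≤ k * b (suc (j + r))) → (k + m) * b r ≤ k * b (m + r)
steady-growth k b r zero _ = ≤-reflexive (cong (_* b r) (+-identityʳ k))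
steady-growth k b r (suc m) grows = begin
  (k + suc m) * b r        ≡⟨ split k m (b r) ⟩
  (k + m) * b r + b r      ≤⟨ +-mono-≤ previous (*-cancelˡ-≤ k b-mono) ⟩
  k * b (m + r) + b (m + r)  ≡⟨ +-comm (k * b (m + r)) (b (m + r)) ⟩
  suc k * b (m + r)        ≤⟨ grows m (n<1+n m) ⟩
  k * b (suc m + r)        ∎
  where
  open ≤-Reasoning
  split : ∀ k m x → (k + suc m) * x ≡ (k + m) * x + x
  split = solve-∀
  previous : (k + m) * b r ≤ k * b (m + r)
  previous = steady-growth k b r m (λ j j<m → grows j (m<n⇒m<1+n j<m))
  b-mono : k * b r ≤ k * b (m + r)
  b-mono = ≤-trans (*-monoˡ-≤ (b r) (m≤m+n k m)) previous

geometric-growth : ∀ k .{{_ : NonZero k}} (b : ℕ → ℕ) q →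
  (∀ r → r < q * k → suc k * b r ≤ k * b (suc r)) → 2 ^ q * b 0 ≤ b (q * k)
geometric-growth k b zero _ = ≤-reflexive (+-identityʳ (b 0))
geometric-growth k b (suc q) grows = begin
  2 ^ suc q * b 0     ≡⟨ *-assoc 2 (2 ^ q) (b 0) ⟩
  2 * (2 ^ q * b 0)   ≤⟨ *-monoʳ-≤ 2 (geometric-growth k b q (λ r r<qk → grows r (<-≤-trans r<qk (m≤n+m (q * k) k)))) ⟩
  2 * b (q * k)       ≤⟨ *-cancelˡ-≤ k (≤-trans (≤-reflexive (double k (b (q * k)))) doubled) ⟩
  b (k + q * k)       ∎
  where
  open ≤-Reasoning
  double : ∀ k x → k * (2 * x) ≡ (k + k) * x
  double = solve-∀
  doubled : (k + k) * b (q * k) ≤ k * b (k + q * k)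
  doubled = steady-growth k b (q * k) k (λ j j<k → grows (j + q * k) (+-monoˡ-< (q * k) j<k))

-- Read s, x, b, t as |S|, |S ∖ B|, |B|, |T| and eS, eT, eX as the numbers of edges
-- inside S, T and S ∖ B, where every edge of S lies inside T or inside S ∖ B.
split-density⇒growth : ∀ N D N′ D′ {s x b t eS eT eX} .{{_ : NonZero D}} →
  s ≡ x + b → eS ≤ eT + eX → N * s ≤ D * (2 * eS) →
  D′ * (2 * eT) < N′ * t → D * (2 * eX) ≤ N * x → N * D′ * b < N′ * D * t
split-density⇒growth N D N′ D′ {x = x} {b} {t} {eS} {eT} {eX} refl eS≤ S-dense T-sparse X-sparse =
  +-cancelˡ-< (D′ * (N * x)) (N * D′ * b) (N′ * D * t) (begin-strict
    D′ * (N * x) + N * D′ * b                  ≡⟨ lhs N D′ x b ⟩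
    D′ * (N * (x + b))                         ≤⟨ *-monoʳ-≤ D′ S-dense ⟩
    D′ * (D * (2 * eS))                        ≤⟨ *-monoʳ-≤ D′ (*-monoʳ-≤ D (*-monoʳ-≤ 2 eS≤)) ⟩
    D′ * (D * (2 * (eT + eX)))                 ≡⟨ middle D D′ eT eX ⟩
    D * (D′ * (2 * eT)) + D′ * (D * (2 * eX))  <⟨ +-mono-<-≤ (*-monoʳ-< D T-sparse) (*-monoʳ-≤ D′ X-sparse) ⟩
    D * (N′ * t) + D′ * (N * x)                ≡⟨ rhs N D N′ D′ x t ⟩
    D′ * (N * x) + N′ * D * t                  ∎)
  where
  open ≤-Reasoning
  lhs : ∀ N D′ x b → D′ * (N * x) + N * D′ * b ≡ D′ * (N * (x + b))
  lhs = solve-∀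
  middle : ∀ D D′ eT eX → D′ * (D * (2 * (eT + eX))) ≡ D * (D′ * (2 * eT)) + D′ * (D * (2 * eX))
  middle = solve-∀
  rhs : ∀ N D N′ D′ x t → D * (N′ * t) + D′ * (N * x) ≡ D′ * (N * x) + N′ * D * t
  rhs = solve-∀

-- Finite sums and vertex sets

listSum-tabulate : ∀ {a} {A : Set a} {k} (f : A → ℕ) (g : Fin k → A) →
  List.sum (map f (tabulate g)) ≡ sum (f ∘ g)
listSum-tabulate {k = zero} f g = refl
listSum-tabulate {k = suc k} f g = cong (f (g zero) +_) (listSum-tabulate f (g ∘ suc))

sum-mono-≤ : ∀ {k} {f g : Fin k → ℕ} → (∀ i → f i ≤ g i) → sum f ≤ sum g
sum-mono-≤ {zero} _ = z≤n
sum-mono-≤ {suc k} f≤g = +-mono-≤ (f≤g zero) (sum-mono-≤ (f≤g ∘ suc))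

term≤sum : ∀ {k} (f : Fin k → ℕ) i → f i ≤ sum f
term≤sum {suc k} f i = ≤-trans (m≤m+n (f i) _) (≤-reflexive (sym (sum-remove {i = i} f)))

sum-pos : ∀ {k} (f : Fin k → ℕ) → 0 < sum f → ∃ λ i → 0 < f i
sum-pos {suc k} f pos with f zero in eq
... | suc _ = zero , subst (0 <_) (sym eq) (s≤s z≤n)
... | zero with sum-pos (f ∘ suc) pos
...   | i , fi>0 = suc i , fi>0

𝟙 : Bool → ℕ
𝟙 b = if b then 1 else 0

∧-intro : ∀ {x y} → x ≡ true → y ≡ true → x ∧ y ≡ true
∧-intro refl refl = refl

𝟙-≤-+ : ∀ {p q r} → (p ≡ true → q ≡ true ⊎ r ≡ true) → 𝟙 p ≤ 𝟙 q + 𝟙 r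
𝟙-≤-+ {false} _ = z≤n
𝟙-≤-+ {true} cover with cover refl
... | inj₁ refl = s≤s z≤n
... | inj₂ refl = m≤n+m 1 _

𝟙-pos : ∀ {b} → 0 < 𝟙 b → b ≡ true
𝟙-pos {true} _ = refl

does-true : ∀ {a} {A : Set a} (d : Dec A) → does d ≡ true → A
does-true (yes a) _ = a

count : ∀ {k} → (Fin k → Bool) → ℕ
count X = sum (𝟙 ∘ X)

count-full : ∀ k → count {k} (λ _ → true) ≡ k
count-full zero = refl
count-full (suc k) = cong suc (count-full k)

module _ {k : ℕ} where

  _∖_ : (Fin k → Bool) → (Fin k → Bool) → Fin k → Bool
  (X ∖ Y) i = X i ∧ not (Y i)

  _⊆_ : (Fin k → Bool) → (Fin k → Bool) → Set
  X ⊆ Y = ∀ {i} → X i ≡ true → Y i ≡ true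

  count-pos : ∀ {X : Fin k → Bool} {i} → X i ≡ true → 0 < count X
  count-pos {X} {i} i∈X = ≤-trans (≤-reflexive (cong 𝟙 (sym i∈X))) (term≤sum (𝟙 ∘ X) i)

  count≤ : (X : Fin k → Bool) → count X ≤ k
  count≤ X = ≤-trans (sum-mono-≤ (λ i → 𝟙≤1 (X i))) (≤-reflexive (count-full k))
    where
    𝟙≤1 : ∀ b → 𝟙 b ≤ 1
    𝟙≤1 true = ≤-refl
    𝟙≤1 false = z≤n

  count-∖ : ∀ {S B} → B ⊆ S → count S ≡ count (S ∖ B) + count B
  count-∖ {S} {B} B⊆S = trans (sum-cong-≗ pointwise) (∑-distrib-+ (𝟙 ∘ (S ∖ B)) (𝟙 ∘ B))
    where
    pointwise : ∀ i → 𝟙 (S i) ≡ 𝟙 ((S ∖ B) i) + 𝟙 (B i)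
    pointwise i with S i in Si | B i in Bi
    ... | true  | true  = refl
    ... | true  | false = refl
    ... | false | false = refl
    ... | false | true with () ← trans (sym Si) (B⊆S Bi)

  count-∖-< : ∀ {S B i} → B ⊆ S → B i ≡ true → count (S ∖ B) < count S
  count-∖-< {S} {B} B⊆S i∈B = subst (count (S ∖ B) <_) (sym (count-∖ B⊆S)) (m<m+n (count (S ∖ B)) (count-pos i∈B))

members : ∀ {k} (X : Fin k → Bool) → Fin (count X) → Fin k
members {suc k} X i with X zero
members {suc k} X zero    | true  = zero
members {suc k} X (suc i) | true  = suc (members (X ∘ suc) i)
members {suc k} X i       | false = suc (members (X ∘ suc) i)

members-injective : ∀ {k} (X : Fin k → Bool) {i j} → members X i ≡ members X j → i ≡ j
members-injective {suc k} X {i} {j} eq with X zero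
members-injective {suc k} X {zero}  {zero}  eq | true  = refl
members-injective {suc k} X {suc i} {suc j} eq | true  = cong suc (members-injective (X ∘ suc) (suc-injective eq))
members-injective {suc k} X {i}     {j}     eq | false = members-injective (X ∘ suc) (suc-injective eq)

members-∈ : ∀ {k} (X : Fin k → Bool) i → X (members X i) ≡ true
members-∈ {suc k} X i with X zero in X0
members-∈ {suc k} X zero    | true  = X0
members-∈ {suc k} X (suc i) | true  = members-∈ (X ∘ suc) i
members-∈ {suc k} X i       | false = members-∈ (X ∘ suc) i

members-surjective : ∀ {k} (X : Fin k → Bool) {u} → X u ≡ true → ∃ λ i → members X i ≡ u
members-surjective {suc k} X {u} u∈X with X zero in X0
members-surjective {suc k} X {zero}  u∈X | true  = zero , refl
members-surjective {suc k} X {suc u} u∈X | true  with members-surjective (X ∘ suc) u∈X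
... | i , eq = suc i , cong suc eq
members-surjective {suc k} X {zero}  u∈X | false with () ← trans (sym u∈X) X0
members-surjective {suc k} X {suc u} u∈X | false with members-surjective (X ∘ suc) u∈X
... | i , eq = i , cong suc eq

members-<ᵇ : ∀ {k} (X : Fin k → Bool) i j → (toℕ (members X i) <ᵇ toℕ (members X j)) ≡ (toℕ i <ᵇ toℕ j)
members-<ᵇ {suc k} X i j with X zero
members-<ᵇ {suc k} X zero    zero    | true  = refl
members-<ᵇ {suc k} X zero    (suc j) | true  = refl
members-<ᵇ {suc k} X (suc i) zero    | true  = refl
members-<ᵇ {suc k} X (suc i) (suc j) | true  = members-<ᵇ (X ∘ suc) i j
members-<ᵇ {suc k} X i       j       | false = members-<ᵇ (X ∘ suc) i j

sum-members : ∀ {k} (X : Fin k → Bool) (f : Fin k → ℕ) → sum (f ∘ members X) ≡ sum (λ a → if X a then f a else 0)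
sum-members {zero}  X f = refl
sum-members {suc k} X f with X zero
... | true  = cong (f zero +_) (sum-members (X ∘ suc) (f ∘ suc))
... | false = sum-members (X ∘ suc) (f ∘ suc)

-- Edges, walks and induced subgraphs

Edge : (G : Graph) → Fin (n G) → Fin (n G) → Bool
Edge G a b = (toℕ a <ᵇ toℕ b) ∧ adj G a b

edgeCount≡∑Edge : ∀ G → edgeCount G ≡ sum λ a → sum λ b → 𝟙 (Edge G a b)
edgeCount≡∑Edge G =
  trans (listSum-tabulate row (λ i → i)) (sum-cong-≗ λ a → listSum-tabulate (𝟙 ∘ Edge G a) (λ i → i))
  where
  row : Fin (n G) → ℕ
  row a = List.sum (map (𝟙 ∘ Edge G a) (allFin (n G)))

module _ (G : Graph) where

  private
    V : Set
    V = Fin (n G)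

  edges : (V → Bool) → ℕ
  edges X = sum λ a → sum λ b → 𝟙 (X a ∧ X b ∧ Edge G a b)

  -- average degree of G[X] at least N/D
  Dense : ℕ → ℕ → (V → Bool) → Set
  Dense N D X = N * count X ≤ D * (2 * edges X)

  edges-pos : ∀ {X} → 0 < edges X → ∃₂ λ a b → X a ≡ true × toℕ a < toℕ b
  edges-pos {X} pos with sum-pos _ pos
  ... | a , pos′ with sum-pos (λ b → 𝟙 (X a ∧ X b ∧ Edge G a b)) pos′
  ...   | b , pos″ = a , b , ∧-conicalˡ (X a) _ edge , <ᵇ⇒< (toℕ a) (toℕ b) (Equivalence.from T-≡ a<b)
    where
    edge : X a ∧ X b ∧ Edge G a b ≡ true
    edge = 𝟙-pos pos″
    a<b : (toℕ a <ᵇ toℕ b) ≡ true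
    a<b = ∧-conicalˡ (toℕ a <ᵇ toℕ b) _ (∧-conicalʳ (X b) _ (∧-conicalʳ (X a) _ edge))

  edges-∖ : ∀ {S B B′} → B ⊆ B′ →
    (∀ {a b} → B a ≡ true → S b ≡ true → adj G a b ≡ true → B′ b ≡ true) →
    edges S ≤ edges B′ + edges (S ∖ B)
  edges-∖ {S} {B} {B′} B⊆B′ closed = begin
    edges S
      ≤⟨ sum-mono-≤ (λ a → sum-mono-≤ (λ b → 𝟙-≤-+ (cover a b))) ⟩
    sum (λ a → sum λ b → 𝟙 (inB′ a b) + 𝟙 (outB a b))
      ≡⟨ sum-cong-≗ (λ a → ∑-distrib-+ (𝟙 ∘ inB′ a) (𝟙 ∘ outB a)) ⟩
    sum (λ a → edgesFrom B′ a + edgesFrom (S ∖ B) a)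
      ≡⟨ ∑-distrib-+ (edgesFrom B′) (edgesFrom (S ∖ B)) ⟩
    edges B′ + edges (S ∖ B)
      ∎
    where
    open ≤-Reasoning
    edgesFrom : (V → Bool) → V → ℕ
    edgesFrom X a = sum λ b → 𝟙 (X a ∧ X b ∧ Edge G a b)
    inB′ outB : V → V → Bool
    inB′ a b = B′ a ∧ B′ b ∧ Edge G a b
    outB a b = (S ∖ B) a ∧ (S ∖ B) b ∧ Edge G a b
    cover : ∀ a b → S a ∧ S b ∧ Edge G a b ≡ true → inB′ a b ≡ true ⊎ outB a b ≡ true
    cover a b h = cover′ (∧-conicalˡ (S a) _ h) (∧-conicalˡ (S b) _ SbE) edge (∧-conicalʳ (toℕ a <ᵇ toℕ b) _ edge)
      where
      SbE : S b ∧ Edge G a b ≡ true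
      SbE = ∧-conicalʳ (S a) _ h
      edge : Edge G a b ≡ true
      edge = ∧-conicalʳ (S b) _ SbE
      cover′ : S a ≡ true → S b ≡ true → Edge G a b ≡ true → adj G a b ≡ true → inB′ a b ≡ true ⊎ outB a b ≡ true
      cover′ Sa Sb E ab with B a in Ba | B b in Bb
      ... | true  | _     = inj₁ (∧-intro (B⊆B′ Ba) (∧-intro (closed Ba Sb ab) E))
      ... | false | true  = inj₁ (∧-intro (closed Bb Sa (trans (adj-sym G b a) ab)) (∧-intro (B⊆B′ Bb) E))
      ... | false | false = inj₂ (∧-intro (∧-intro Sa refl) (∧-intro (∧-intro Sb refl) E))

-- Only the vertices after the first are required to lie in X.
data WalkIn (G : Graph) (X : Fin (n G) → Bool) : Fin (n G) → Fin (n G) → ℕ → Set where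
  here : ∀ {u} → WalkIn G X u u 0
  step : ∀ {u w v l} → adj G u w ≡ true → X w ≡ true → WalkIn G X w v l → WalkIn G X u v (suc l)

module _ {G : Graph} where

  _++ʷ_ : ∀ {X u w v l m} → WalkIn G X u w l → WalkIn G X w v m → WalkIn G X u v (l + m)
  here ++ʷ q = q
  step uw w∈X p ++ʷ q = step uw w∈X (p ++ʷ q)

  reverseʷ : ∀ {X u v l} → X u ≡ true → WalkIn G X u v l → WalkIn G X v u l
  reverseʷ u∈X here = here
  reverseʷ {X} {u} {v} u∈X (step {w = w} {l = l} uw w∈X p) =
    subst (WalkIn G X v u) (+-comm l 1) (reverseʷ w∈X p ++ʷ step (trans (adj-sym G w u) uw) u∈X here)

  weakenʷ : ∀ {X Y u v l} → X ⊆ Y → WalkIn G X u v l → WalkIn G Y u v l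
  weakenʷ X⊆Y here = here
  weakenʷ X⊆Y (step uw w∈X p) = step uw (X⊆Y w∈X) (weakenʷ X⊆Y p)

module _ (G : Graph) where

  private
    V : Set
    V = Fin (n G)

  DiameterIn : (V → Bool) → ℕ → Set
  DiameterIn X L = ∀ {u w} → X u ≡ true → X w ≡ true → ∃ λ l → l ≤ L × WalkIn G X u w l

  induced : (V → Bool) → Graph
  induced X = record
    { n      = count X
    ; adj    = λ i j → adj G (members X i) (members X j)
    ; sym    = λ i j → adj-sym G (members X i) (members X j)
    ; irrefl = λ i → irrefl G (members X i)
    }

  induced-subgraph : ∀ X → Subgraph (induced X) G
  induced-subgraph X = record { emb = members X ; emb-inj = members-injective X ; emb-adj = λ _ _ ij → ij }

  edgeCount-induced : ∀ X → edgeCount (induced X) ≡ edges G X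
  edgeCount-induced X = begin
    edgeCount (induced X)
      ≡⟨ edgeCount≡∑Edge (induced X) ⟩
    (sum λ i → sum λ j → 𝟙 (Edge (induced X) i j))
      ≡⟨ sum-cong-≗ (λ i → sum-cong-≗ (λ j →
           cong (λ c → 𝟙 (c ∧ adj G (members X i) (members X j))) (sym (members-<ᵇ X i j)))) ⟩
    (sum λ i → sum λ j → 𝟙 (Edge G (members X i) (members X j)))
      ≡⟨ sum-cong-≗ (λ i → sum-members X (λ b → 𝟙 (Edge G (members X i) b))) ⟩
    (sum λ i → sum λ b → if X b then 𝟙 (Edge G (members X i) b) else 0)
      ≡⟨ sum-members X (λ a → sum λ b → if X b then 𝟙 (Edge G a b) else 0) ⟩
    (sum λ a → if X a then (sum λ b → if X b then 𝟙 (Edge G a b) else 0) else 0)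
      ≡⟨ sum-cong-≗ (λ a → restrict (X a) (λ b → if X b then 𝟙 (Edge G a b) else 0)) ⟩
    (sum λ a → sum λ b → if X a then (if X b then 𝟙 (Edge G a b) else 0) else 0)
      ≡⟨ sum-cong-≗ (λ a → sum-cong-≗ (λ b → 𝟙-∧∧ (X a) (X b) (Edge G a b))) ⟩
    edges G X ∎
    where
    open ≡-Reasoning
    restrict : ∀ x (f : V → ℕ) → (if x then sum f else 0) ≡ sum (λ b → if x then f b else 0)
    restrict true f = refl
    restrict false f = sym (sum-replicate-zero (n G))
    𝟙-∧∧ : ∀ x y e → (if x then (if y then 𝟙 e else 0) else 0) ≡ 𝟙 (x ∧ y ∧ e)
    𝟙-∧∧ true true e = refl
    𝟙-∧∧ true false e = refl
    𝟙-∧∧ false y e = refl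

  walk-induced : ∀ {X u w l} → WalkIn G X u w l → ∀ {i j} → members X i ≡ u → members X j ≡ w → Walk (induced X) i j l
  walk-induced {X} here {i} {j} refl ij with members-injective X ij
  ... | refl = here
  walk-induced {X} (step uw w∈X p) {i} refl refl with members-surjective X w∈X
  ... | m , refl = step uw (walk-induced p refl refl)

  diameter-induced : ∀ {X L} → DiameterIn X L → DiamAtMost (induced X) L
  diameter-induced {X} diam i j with diam (members-∈ X i) (members-∈ X j)
  ... | l , l≤L , p = l , l≤L , walk-induced p refl refl

-- Balls around v in G[S]

module Balls (G : Graph) (S : Fin (n G) → Bool) (v : Fin (n G)) where

  private
    V : Set
    V = Fin (n G)

  ball : ℕ → V → Bool
  ball zero    u = does (u ≟ v)
  ball (suc r) u = ball r u ∨ (S u ∧ does (any? λ w → ball r w ∧ adj G w u ≟ᵇ true))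

  ball-mono : ∀ r → ball r ⊆ ball (suc r)
  ball-mono r u∈B rewrite u∈B = refl

  ball-closed : ∀ r {a b} → ball r a ≡ true → S b ≡ true → adj G a b ≡ true → ball (suc r) b ≡ true
  ball-closed r {a} {b} a∈B b∈S ab
    rewrite b∈S | dec-true (any? λ w → ball r w ∧ adj G w b ≟ᵇ true) (a , ∧-intro a∈B ab) = ∨-zeroʳ (ball r b)

  centre∈ball : ∀ r → ball r v ≡ true
  centre∈ball zero    = dec-true (v ≟ v) refl
  centre∈ball (suc r) = ball-mono r (centre∈ball r)

  ball⊆S : S v ≡ true → ∀ r → ball r ⊆ S
  ball⊆S v∈S zero {u} u∈B with refl ← does-true (u ≟ v) u∈B = v∈S
  ball⊆S v∈S (suc r) {u} u∈B with ball r u in u∈Br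
  ... | true  = ball⊆S v∈S r u∈Br
  ... | false = ∧-conicalˡ (S u) _ u∈B

  walk-to-centre : ∀ r {u} → ball r u ≡ true → ∃ λ l → l ≤ r × WalkIn G (ball r) u v l
  walk-to-centre zero {u} u∈B with refl ← does-true (u ≟ v) u∈B = 0 , z≤n , here
  walk-to-centre (suc r) {u} u∈B with ball r u in u∈Br
  ... | true with walk-to-centre r u∈Br
  ...   | l , l≤r , p = l , m≤n⇒m≤1+n l≤r , weakenʷ (ball-mono r) p
  walk-to-centre (suc r) {u} u∈B | false
    with w , w∈B∧wu ← does-true (any? λ w → ball r w ∧ adj G w u ≟ᵇ true) (∧-conicalʳ (S u) _ u∈B)
    with w∈B ← ∧-conicalˡ (ball r w) _ w∈B∧wu
    with l , l≤r , p ← walk-to-centre r w∈B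
    = suc l , s≤s l≤r ,
      step (trans (adj-sym G u w) (∧-conicalʳ (ball r w) _ w∈B∧wu)) (ball-mono r w∈B) (weakenʷ (ball-mono r) p)

  ball-diameter : ∀ r → DiameterIn G (ball r) (r + r)
  ball-diameter r u∈B w∈B with walk-to-centre r u∈B | walk-to-centre r w∈B
  ... | l , l≤r , p | m , m≤r , q = l + m , +-mono-≤ l≤r m≤r , p ++ʷ reverseʷ w∈B q

-- Densification

module Densification (G : Graph) {N D N′ D′ : ℕ} .{{_ : NonZero D}} .{{_ : NonZero (N′ * D)}}
  (d′<d : N′ * D < N * D′) (2≤n : 2 ≤ n G) where

  private
    V : Set
    V = Fin (n G)
    k : ℕ
    k = N′ * D

  Result : Set
  Result = Σ (V → Bool) λ T → 0 < count T × Dense G N′ D′ T × DiameterIn G T ⌊log₂ (n G ^ (4 * k)) ⌋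

  module _ (S : V → Bool) (v : V) (v∈S : S v ≡ true) where
    open Balls G S v

    Grows : ℕ → Set
    Grows r = N * D′ * count (ball r) < k * count (ball (suc r))

    ball-doubles : ∀ q → (∀ r → r < q * k → Grows r) → 2 ^ q ≤ count (ball (q * k))
    ball-doubles q grows = begin
      2 ^ q                      ≡⟨ *-identityʳ (2 ^ q) ⟨
      2 ^ q * 1                  ≤⟨ *-monoʳ-≤ (2 ^ q) (count-pos {X = ball 0} {i = v} (centre∈ball 0)) ⟩
      2 ^ q * count (ball 0)     ≤⟨ geometric-growth k (count ∘ ball) q (λ r r<qk → by-ratio (grows r r<qk)) ⟩
      count (ball (q * k))       ∎
      where
      open ≤-Reasoning
      by-ratio : ∀ {b b′} → N * D′ * b < k * b′ → suc k * b ≤ k * b′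
      by-ratio {b} g = ≤-trans (*-monoˡ-≤ b d′<d) (<⇒≤ g)

    growth-stops : ¬ (∀ r → r < n G * k → Grows r)
    growth-stops grows = <⇒≱ (n<2^n (n G)) (≤-trans (ball-doubles (n G) grows) (count≤ (ball (n G * k))))

    stalled-radius : ∀ r → (∀ r′ → r′ < r → Grows r′) → suc r + suc r ≤ ⌊log₂ (n G ^ (4 * k)) ⌋
    stalled-radius r grew = begin
      suc r + suc r              ≤⟨ +-mono-≤ r<[1+q]k r<[1+q]k ⟩
      suc q * k + suc q * k      ≡⟨ cong (suc q * k +_) (+-identityʳ (suc q * k)) ⟨
      2 * (suc q * k)            ≤⟨ log₂-radius-bound {q = q} k 2≤n 2^q≤n ⟩
      ⌊log₂ (n G ^ (4 * k)) ⌋    ∎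
      where
      open ≤-Reasoning
      q : ℕ
      q = r DivMod./ k
      r<[1+q]k : suc r ≤ suc q * k
      r<[1+q]k = begin
        suc r                ≡⟨ cong suc (m≡m%n+[m/n]*n r k) ⟩
        suc (r % k + q * k)  ≤⟨ +-monoˡ-≤ (q * k) (m%n<n r k) ⟩
        k + q * k            ∎
      2^q≤n : 2 ^ q ≤ n G
      2^q≤n = ≤-trans (ball-doubles q (λ r′ r′<qk → grew r′ (<-≤-trans r′<qk (m/n*n≤m r k)))) (count≤ (ball (q * k)))

    stalled-ball-diameter : ∀ r → (∀ r′ → r′ < r → Grows r′) → DiameterIn G (ball (suc r)) ⌊log₂ (n G ^ (4 * k)) ⌋
    stalled-ball-diameter r grew u∈B w∈B with ball-diameter (suc r) u∈B w∈B
    ... | l , l≤ , p = l , ≤-trans l≤ (stalled-radius r grew) , p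

    ball-round : Dense G N D S → ∀ r →
      Dense G N′ D′ (ball (suc r)) ⊎ N * count (S ∖ ball r) < D * (2 * edges G (S ∖ ball r)) ⊎ Grows r
    ball-round dense r with N′ * count (ball (suc r)) ≤? D′ * (2 * edges G (ball (suc r)))
                          | D * (2 * edges G (S ∖ ball r)) ≤? N * count (S ∖ ball r)
    ... | yes T-dense | _           = inj₁ T-dense
    ... | no _        | no X-denser = inj₂ (inj₁ (≰⇒> X-denser))
    ... | no T-sparse | yes X-sparse = inj₂ (inj₂ (split-density⇒growth N D N′ D′
      {eT = edges G (ball (suc r))} {eX = edges G (S ∖ ball r)}
      (count-∖ {S = S} {B = ball r} (ball⊆S v∈S r)) (edges-∖ G (ball-mono r) (ball-closed r))
      dense (≰⇒> T-sparse) X-sparse))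

    stage : Dense G N D S → Result ⊎ ∃ λ X → count X < count S × 0 < edges G X × Dense G N D X
    stage dense with least-failure {P = Grows} (λ r → _ <? _) (n G * k)
    ... | inj₁ grows = ⊥-elim (growth-stops grows)
    ... | inj₂ (r , _ , stalls , grew) with ball-round dense r
    ...   | inj₁ T-dense = inj₁ (ball (suc r) , count-pos {X = ball (suc r)} (centre∈ball (suc r)) ,
                                 T-dense , stalled-ball-diameter r grew)
    ...   | inj₂ (inj₁ X-denser) = inj₂ (S ∖ ball r , count-∖-< {S = S} {B = ball r} (ball⊆S v∈S r) (centre∈ball r) ,
                                         m<n*[2*o]⇒0<o D _ X-denser , <⇒≤ X-denser)
    ...   | inj₂ (inj₂ growth) = ⊥-elim (stalls growth)

  densify : ∀ S → Acc (_<_ on count) S → 0 < edges G S → Dense G N D S → Result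
  densify S (acc smaller) e>0 dense with v , _ , v∈S , _ ← edges-pos G e>0 | stage S v v∈S dense
  ... | inj₁ result = result
  ... | inj₂ (X , X<S , e>0′ , dense′) = densify X (smaller X<S) e>0′ dense′

dense-subgraph-of-small-diameter : ∀ (G : Graph) {N D N′ D′} .{{_ : NonZero D}} → 0 < N′ → N′ * D < N * D′ →
  0 < n G → N * n G ≤ D * (2 * edgeCount G) →
  Σ Graph λ H → Subgraph H G × 0 < n H × N′ * n H ≤ D′ * (2 * edgeCount H) ×
    DiamAtMost H ⌊log₂ (n G ^ (4 * (N′ * D))) ⌋
dense-subgraph-of-small-diameter G {N} {D} {N′} {D′} 0<N′ d′<d 0<n G-dense
  = let T , 0<|T| , T-dense , T-diam =
          Densification.densify G {N} {D} {N′} {D′} d′<d 2≤n full (On.wellFounded count <-wellFounded full) 0<e full-dense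
    in induced G T , induced-subgraph G T , 0<|T| ,
       subst (λ e → N′ * count T ≤ D′ * (2 * e)) (sym (edgeCount-induced G T)) T-dense ,
       diameter-induced G T-diam
  where
  instance
    N′D≢0 : NonZero (N′ * D)
    N′D≢0 = m*n≢0 N′ D {{>-nonZero 0<N′}}
  full : Fin (n G) → Bool
  full _ = true
  full-dense : Dense G N D full
  full-dense = subst₂ (λ m e → N * m ≤ D * (2 * e)) (sym (count-full (n G))) (edgeCount≡∑Edge G) G-dense
  0<e : 0 < edges G full
  0<e = subst (0 <_) (edgeCount≡∑Edge G)
          (m<n*[2*o]⇒0<o D (edgeCount G) (<-≤-trans (*-mono-≤ (m<n*o⇒0<n {n = N} d′<d) 0<n) G-dense))
  2≤n : 2 ≤ n G
  2≤n with _ , b , _ , a<b ← edges-pos G {X = full} 0<e = ≤-trans (s≤s (≤-trans (s≤s z≤n) a<b)) (toℕ<n b)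

-- Rational average degrees

toℚᵘ-ℕ→ℚ : ∀ m → toℚᵘ (ℕ→ℚ m) ℚᵘ.≃ mkℚᵘ (ℤ.+ m) 0
toℚᵘ-ℕ→ℚ m = ℚ.toℚᵘ-fromℚᵘ (mkℚᵘ (ℤ.+ m) 0)

scaled-≤⇔ᵘ : ∀ q m e →
  (q ℚ.* ℕ→ℚ m ℚ.≤ ℕ→ℚ e) ⇔ (toℚᵘ q ℚᵘ.* mkℚᵘ (ℤ.+ m) 0 ℚᵘ.≤ mkℚᵘ (ℤ.+ e) 0)
scaled-≤⇔ᵘ q m e = mk⇔
  (λ h → ℚᵘ.≤-respʳ-≃ (toℚᵘ-ℕ→ℚ e) (ℚᵘ.≤-respˡ-≃ toℚᵘ-product (ℚ.toℚᵘ-mono-≤ h)))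
  (λ h → ℚ.toℚᵘ-cancel-≤
    (ℚᵘ.≤-respʳ-≃ (ℚᵘ.≃-sym (toℚᵘ-ℕ→ℚ e)) (ℚᵘ.≤-respˡ-≃ (ℚᵘ.≃-sym toℚᵘ-product) h)))
  where
  toℚᵘ-product : toℚᵘ (q ℚ.* ℕ→ℚ m) ℚᵘ.≃ toℚᵘ q ℚᵘ.* mkℚᵘ (ℤ.+ m) 0
  toℚᵘ-product = ℚᵘ.≃-trans (ℚ.toℚᵘ-homo-* q (ℕ→ℚ m)) (ℚᵘ.*-congˡ {toℚᵘ q} (toℚᵘ-ℕ→ℚ m))

scaled-≤⇔ : ∀ {N D-1} .(c : Coprime N (suc D-1)) m e →
  (mkℚ (ℤ.+ N) D-1 c ℚ.* ℕ→ℚ m ℚ.≤ ℕ→ℚ e) ⇔ (N * m ≤ suc D-1 * e)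
scaled-≤⇔ {N} {D-1} c m e = ⇔.trans (scaled-≤⇔ᵘ (mkℚ (ℤ.+ N) D-1 c) m e) (mk⇔
  (λ { (*≤* h) → ℤ.drop‿+≤+ (subst₂ ℤ._≤_ lhs rhs h) })
  (λ h → *≤* (subst₂ ℤ._≤_ (sym lhs) (sym rhs) (ℤ.+≤+ h))))
  where
  lhs : (ℤ.+ N ℤ.* ℤ.+ m) ℤ.* ℤ.+ 1 ≡ ℤ.+ (N * m)
  lhs = trans (ℤ.*-identityʳ _) (sym (ℤ.pos-* N m))
  rhs : ℤ.+ e ℤ.* ℤ.+ (suc D-1 * 1) ≡ ℤ.+ (suc D-1 * e)
  rhs = trans (sym (ℤ.pos-* e _)) (cong ℤ.+_ (trans (cong (e *_) (*-identityʳ (suc D-1))) (*-comm e (suc D-1))))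

2≤⇒ : ∀ {N D-1} .(c : Coprime N (suc D-1)) → ℕ→ℚ 2 ℚ.≤ mkℚ (ℤ.+ N) D-1 c → 2 * suc D-1 ≤ N
2≤⇒ {N} {D-1} c (ℚ.*≤* h) = ℤ.drop‿+≤+ (subst₂ ℤ._≤_ (sym (ℤ.pos-* 2 (suc D-1))) (ℤ.*-identityʳ (ℤ.+ N)) h)

2≰negative : ∀ {k D-1} .(c : Coprime (suc k) (suc D-1)) → ¬ (ℕ→ℚ 2 ℚ.≤ mkℚ ℤ.-[1+ k ] D-1 c)
2≰negative c (ℚ.*≤* ())

<⇒cross-< : ∀ {N D-1 N′ D′-1} .(c : Coprime N (suc D-1)) .(c′ : Coprime N′ (suc D′-1)) →
  mkℚ (ℤ.+ N′) D′-1 c′ ℚ.< mkℚ (ℤ.+ N) D-1 c → N′ * suc D-1 < N * suc D′-1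
<⇒cross-< {N} {D-1} {N′} {D′-1} c c′ (ℚ.*<* h) =
  ℤ.drop‿+<+ (subst₂ ℤ._<_ (sym (ℤ.pos-* N′ (suc D-1))) (sym (ℤ.pos-* N (suc D′-1))) h)

diameterFactor : ℚ → ℚ → ℕ
diameterFactor d d′ = 4 * (ℤ.∣ ℚ.↥ d′ ∣ * ℚ.↧ₙ d)

lemma3p1 : Σ (ℚ → ℚ → ℕ) λ p →
    (d d′ : ℚ) → ℕ→ℚ 2 ℚ.≤ d′ → d′ ℚ.< d →
    (G : Graph) → AvgDegAtLeast G d →
    Σ Graph λ H → Subgraph H G × AvgDegAtLeast H d′ ×
    DiamAtMost H ⌊log₂ (∣ G ∣ᵥ ^ p d d′) ⌋
lemma3p1 = diameterFactor , λ where
  (mkℚ ℤ.-[1+ _ ] _ _) d′ 2≤d′ d′<d _ _ → ⊥-elim (2≰negative _ (ℚ.≤-trans 2≤d′ (ℚ.<⇒≤ d′<d)))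
  d (mkℚ ℤ.-[1+ _ ] _ _) 2≤d′ _ _ _ → ⊥-elim (2≰negative _ 2≤d′)
  (mkℚ (ℤ.+ N) D-1 c) (mkℚ (ℤ.+ N′) D′-1 c′) 2≤d′ d′<d G (0<n , G-avg) →
    let H , H⊆G , 0<|H| , H-dense , H-diam =
          dense-subgraph-of-small-diameter G {N} {suc D-1} {N′} {suc D′-1}
            (<-≤-trans (s≤s z≤n) (2≤⇒ c′ 2≤d′)) (<⇒cross-< c c′ d′<d) 0<n
            (Equivalence.to (scaled-≤⇔ c (n G) (2 * edgeCount G)) G-avg)
    in H , H⊆G , (0<|H| , Equivalence.from (scaled-≤⇔ c′ (n H) (2 * edgeCount H)) H-dense) , H-diam
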